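{- Let $\pi=\alpha\,u\,v\,\beta\in\mathfrak S_n$ and $\rho=\alpha\,v\,u\,\beta$, where $\alpha,\beta$ are words and $u<v$. If the pair $(u,v)$ is Tonks-independent in $\pi$, i.e. some entry of $\beta$ lies strictly between $u$ and $v$, then $h(w(\pi))=_{\mathcal I}h(w(\rho))$, and consequently $\phi(\pi)=\phi(\rho)$.
   Context: $\mathfrak S_n$ is the symmetric group on $[n]$ in one-line notation. $w(a)$ denotes the reversal of a word $a$. For $n\ge1$, $Y_n$ is the set of planar binary trees with $n$ internal nodes ($n+1$ leaves ordered left to right); $Y_0=\{\ast\}$, the trivial one-vertex tree; $t\in Y_1$ is the 2-corolla and $T\triangleleft_i t$ is the tree obtained by grafting $t$ onto the $i$-th leaf of $T$; $\mathrm{std}$ denotes standardization of words of distinct integers. Tonks' vertex map $\phi:\mathfrak S_n\to Y_n$ (restriction to vertices of Tonks' projection from the permutohedron to the associahedron): $\phi(\emptyset)=\ast$, $\phi(1)=t$, $\phi(\pi)=\phi(\mathrm{std}(\pi_2\cdots\pi_n))\triangleleft_{\pi_1}t$ for $n>1$. Indexed terms: $\mathcal L^I$ is generated by symbols $\mathbf 2^k$ ($k$ a positive integer) of arity $2$, and for terms $\mathbf A,\mathbf B$ and $1\le m\le|\mathbf A|$ the term $\mathbf A\circ_m\mathbf B$ of arity $|\mathbf A|+|\mathbf B|-1$; no index occurs more than once. $=_{\mathcal I}$ is the smallest congruence on $\mathcal L^I$ containing all instances of (assoc1) $(\mathbf A\circ_n\mathbf B)\circ_m\mathbf C=\mathbf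 A\circ_n(\mathbf B\circ_{m-n+1}\mathbf C)$ if $n\le m<n+|\mathbf B|$, and (assoc2) $(\mathbf A\circ_n\mathbf B)\circ_m\mathbf C=(\mathbf A\circ_{m-|\mathbf B|+1}\mathbf C)\circ_n\mathbf B$ if $n+|\mathbf B|\le m$. Head-insertion encoding: for a word $a=a_1\cdots a_n$ of distinct positive integers, $h(a_1)=\mathbf 2^{a_1}$ and $h(a)=h(a_1\cdots a_{n-1})\circ_r\mathbf 2^{a_n}$ with $r=1+|\{j<n:a_j<a_n\}|$ for $n>1$. -}

module Defs where

open import Data.Nat using (ℕ; zero; suc; _+_; _∸_; _≤_; _<_; _<?_; _≤?_)
open import Data.List using (List; []; _∷_; _++_; length; filter; map; upTo; [_])
open import Data.List.Relation.Binary.Permutation.Propositional using (_↭_)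
open import Data.List.Relation.Unary.Unique.Propositional using (Unique)
open import Relation.Nullary using (does)
open import Data.Bool using (if_then_else_)

IsPerm : ℕ → List ℕ → Set
IsPerm n π = π ↭ map suc (upTo n)

rank : ℕ → List ℕ → ℕ
rank x a = suc (length (filter (_<? x) a))

std : List ℕ → List ℕ
std a = map (λ x → rank x a) a

data Tree : Set where
  leaf : Tree
  node : Tree → Tree → Tree

leaves : Tree → ℕ
leaves leaf       = 1
leaves (node l r) = leaves l + leaves r

corolla : Tree
corolla = node leaf leaf

-- graft T i s : graft s onto the i-th leaf (1-indexed) of T.
-- (Out-of-range i leaves T unchanged; never used in range-valid calls.)
graft : Tree → ℕ → Tree → Tree
graft leaf       1 s = s
graft leaf       _ s = leaf
graft (node l r) i s =
  if does (i ≤? leaves l)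
  then node (graft l i s) r
  else node l (graft r (i ∸ leaves l) s)

-- Tonks' vertex map φ, with a fuel argument equal to the word length
-- (std preserves length, so fuel = length is always sufficient).
φ-aux : ℕ → List ℕ → Tree
φ-aux _       []           = leaf
φ-aux zero    (x ∷ xs)     = leaf
φ-aux (suc k) (x ∷ [])     = corolla
φ-aux (suc k) (x ∷ y ∷ ys) = graft (φ-aux k (std (y ∷ ys))) x corolla

φ : List ℕ → Tree
φ π = φ-aux (length π) π

infixl 6 _∘⟨_⟩_
data Term : Set where
  two    : ℕ → Term
  _∘⟨_⟩_ : Term → ℕ → Term → Term

arity : Term → ℕ
arity (two k)       = 2
arity (A ∘⟨ m ⟩ B)  = arity A + arity B ∸ 1

indices : Term → List ℕ
indices (two k)      = k ∷ []
indices (A ∘⟨ m ⟩ B) = indices A ++ indices B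

data Shape : Term → Set where
  sh-two  : ∀ {k} → 1 ≤ k → Shape (two k)
  sh-comp : ∀ {A B m} → Shape A → Shape B → 1 ≤ m → m ≤ arity A →
            Shape (A ∘⟨ m ⟩ B)

WF : Term → Set
WF T = Shape T × Unique (indices T)
  where open import Data.Product using (_×_)

-- All related terms are well-formed (axiom instances and congruence
-- steps are required to have a well-formed left-hand side; reflexivity
-- only on well-formed terms).

infix 4 _=I_
data _=I_ : Term → Term → Set where
  =I-refl  : ∀ {A} → WF A → A =I A
  =I-sym   : ∀ {A B} → A =I B → B =I A
  =I-trans : ∀ {A B C} → A =I B → B =I C → A =I C
  =I-cong  : ∀ {A A' B B' m} → WF (A ∘⟨ m ⟩ B) → A =I A' → B =I B' →
             A ∘⟨ m ⟩ B =I A' ∘⟨ m ⟩ B'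
  assoc1   : ∀ {A B C n m} → WF ((A ∘⟨ n ⟩ B) ∘⟨ m ⟩ C) →
             n ≤ m → m < n + arity B →
             (A ∘⟨ n ⟩ B) ∘⟨ m ⟩ C =I A ∘⟨ n ⟩ (B ∘⟨ m ∸ n + 1 ⟩ C)
  assoc2   : ∀ {A B C n m} → WF ((A ∘⟨ n ⟩ B) ∘⟨ m ⟩ C) →
             n + arity B ≤ m →
             (A ∘⟨ n ⟩ B) ∘⟨ m ⟩ C =I (A ∘⟨ m ∸ arity B + 1 ⟩ C) ∘⟨ n ⟩ B

-- Head-insertion encoding h.  h (a₁ ⋯ aₙ) built left to right:
-- insert aₙ at position r = 1 + #{j < n : aⱼ < aₙ}.
-- h [] is junk (two 0); it is never used on empty words here.

h-go : Term → List ℕ → List ℕ → Term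
h-go acc seen []       = acc
h-go acc seen (y ∷ ys) =
  h-go (acc ∘⟨ rank y seen ⟩ two y) (seen ++ [ y ]) ys

h : List ℕ → Term
h []       = two 0
h (x ∷ xs) = h-go (two x) [ x ] xs

{-# OPTIONS --safe #-}
-- The letter x, strictly between u and v, separates their ranks: in any list containing x,
-- fewer letters lie below u than below v.  In the reversed words all of w(β), x included, is
-- inserted before u and v, so h attaches their 2-corollas at positions rank u < rank v of the
-- same term, where (assoc2) interchanges them; later insertions see the same set of earlier
-- letters.  For φ, standardizing the prefix α away letter by letter keeps x between u and v;
-- once the word starts with u v, both φ(π) and φ(ρ) graft corollas onto φ(std β) at the
-- distinct leaves rank u β < rank v β, in the two orders, and such grafts commute.
module Submission where

open import Defs
open import Data.Nat using (ℕ; zero; suc; _+_; _∸_; _≤_; _<_; z≤n; s≤s; s≤s⁻¹; _<?_; _≤?_)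
open import Data.Nat.Properties
open import Data.List using (List; []; _∷_; [_]; _++_; _∷ʳ_; length; map; filter; reverse; upTo)
open import Data.List.Properties
  using (length-map; length-filter; length-upTo; length-++; map-++; map-∘; map-cong;
         filter-accept; filter-reject; filter-all; filter-++; ++-assoc; ++-identityʳ; upTo-∷ʳ; reverse-++)
open import Data.List.Membership.Propositional using (_∈_)
open import Data.List.Membership.Propositional.Properties
  using (∈-∃++; ∈-++⁺ʳ; ∈-map⁺; ∈-map⁻; ∈-upTo⁻)
open import Data.List.Relation.Binary.Subset.Propositional using (_⊆_)
open import Data.List.Relation.Binary.Sublist.Propositional using (⊆-refl)
open import Data.List.Relation.Binary.Sublist.Propositional.Properties using (filter⁺)
open import Data.List.Relation.Binary.Sublist.Heterogeneous.Properties using (length-mono-≤)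
open import Data.List.Relation.Binary.Permutation.Propositional
  using (_↭_; ↭-refl; ↭-sym; ↭-trans; ↭⇒↭ₛ; swap)
open import Data.List.Relation.Binary.Permutation.Propositional.Properties
  using (↭-length; filter-↭; shift; ∷↭∷ʳ; ++⁺ˡ; ++⁺ʳ; ↭-reverse; All-resp-↭; ∈-resp-↭)
open import Data.List.Relation.Binary.Permutation.Setoid.Properties using (Unique-resp-↭)
open import Data.List.Relation.Unary.All as All using (All; []; _∷_)
open import Data.List.Relation.Unary.All.Properties using (map⁺; all-upTo; ++⁻ˡ)
open import Data.List.Relation.Unary.AllPairs using ([]; _∷_)
open import Data.List.Relation.Unary.Any using (here; there)
open import Data.List.Relation.Unary.Any.Properties using (reverse⁺)
open import Data.List.Relation.Unary.Unique.Propositional using (Unique)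
import Data.List.Relation.Unary.Unique.Propositional.Properties as Unique
open import Data.Product using (_×_; _,_; ∃-syntax)
open import Function using (_∘_; id)
open import Relation.Binary.PropositionalEquality
  using (_≡_; refl; sym; trans; cong; cong₂; subst; subst₂; setoid; module ≡-Reasoning)
open import Relation.Nullary using (¬_; yes; no)
open import Relation.Nullary.Decidable using (dec-true; dec-false)

rank-∷-< : ∀ {x y} l → y < x → rank x (y ∷ l) ≡ suc (rank x l)
rank-∷-< {x} l y<x = cong (suc ∘ length) (filter-accept (_<? x) y<x)

rank-∷-≮ : ∀ {x y} l → ¬ y < x → rank x (y ∷ l) ≡ rank x l
rank-∷-≮ {x} l y≮x = cong (suc ∘ length) (filter-reject (_<? x) y≮x)

rank-↭ : ∀ x {l l′} → l ↭ l′ → rank x l ≡ rank x l′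
rank-↭ x p = cong suc (↭-length (filter-↭ (_<? x) p))

rank-∷ʳ-< : ∀ {x y} l → y < x → rank x (l ∷ʳ y) ≡ suc (rank x l)
rank-∷ʳ-< {x} {y} l y<x = trans (rank-↭ x (↭-sym (∷↭∷ʳ y l))) (rank-∷-< l y<x)

rank-∷ʳ-≮ : ∀ {x y} l → ¬ y < x → rank x (l ∷ʳ y) ≡ rank x l
rank-∷ʳ-≮ {x} {y} l y≮x = trans (rank-↭ x (↭-sym (∷↭∷ʳ y l))) (rank-∷-≮ l y≮x)

rank-≤ : ∀ x l → rank x l ≤ suc (length l)
rank-≤ x l = s≤s (length-filter (_<? x) l)

rank-mono : ∀ {x y} → x ≤ y → ∀ l → rank x l ≤ rank y l
rank-mono {x} {y} x≤y l = s≤s (length-mono-≤ (filter⁺ (_<? x) (_<? y) z<x⇒z<y (⊆-refl {x = l})))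
  where
    z<x⇒z<y : ∀ {z z′} → z ≡ z′ → z < x → z′ < y
    z<x⇒z<y refl z<x = <-≤-trans z<x x≤y

rank-< : ∀ {x y l} → x < y → x ∈ l → rank x l < rank y l
rank-< {x} {y} x<y x∈l with l₁ , l₂ , refl ← ∈-∃++ x∈l = begin-strict
  rank x (l₁ ++ [ x ] ++ l₂)  ≡⟨ rank-↭ x (shift x l₁ l₂) ⟩
  rank x (x ∷ l₁ ++ l₂)       ≡⟨ rank-∷-≮ (l₁ ++ l₂) (n≮n x) ⟩
  rank x (l₁ ++ l₂)           ≤⟨ rank-mono (<⇒≤ x<y) (l₁ ++ l₂) ⟩
  rank y (l₁ ++ l₂)           <⟨ n<1+n _ ⟩
  suc (rank y (l₁ ++ l₂))     ≡⟨ rank-∷-< (l₁ ++ l₂) x<y ⟨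
  rank y (x ∷ l₁ ++ l₂)       ≡⟨ rank-↭ y (shift x l₁ l₂) ⟨
  rank y (l₁ ++ [ x ] ++ l₂)  ∎
  where open ≤-Reasoning

rank-between : ∀ {u x v l} → u < x → x < v → x ∈ l → rank u l < rank v l
rank-between {l = l} u<x x<v x∈l = ≤-<-trans (rank-mono (<⇒≤ u<x) l) (rank-< x<v x∈l)

rank-map : ∀ (f : ℕ → ℕ) {x} l → All (λ y → (y < x → f y < f x) × (f y < f x → y < x)) l →
           rank (f x) (map f l) ≡ rank x l
rank-map f     []      []                  = refl
rank-map f {x} (y ∷ l) ((pres , reflect) ∷ ps) with y <? x
... | yes y<x = trans (rank-∷-< (map f l) (pres y<x))
                      (trans (cong suc (rank-map f l ps)) (sym (rank-∷-< l y<x)))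
... | no  y≮x = trans (rank-∷-≮ (map f l) (y≮x ∘ reflect))
                      (trans (rank-map f l ps) (sym (rank-∷-≮ l y≮x)))

rank-rank : ∀ {s l} x → l ⊆ s → rank (rank x s) (map (λ y → rank y s) l) ≡ rank x l
rank-rank {s} {l} x l⊆s = rank-map (λ y → rank y s) l (All.tabulate λ y∈l →
  (λ y<x → rank-< y<x (l⊆s y∈l)) ,
  (λ ry<rx → ≰⇒> (λ x≤y → <⇒≱ ry<rx (rank-mono x≤y s))))

std-relabel : ∀ {s l} → l ⊆ s → std (map (λ y → rank y s) l) ≡ std l
std-relabel {s} {l} l⊆s = trans (sym (map-∘ l)) (map-cong (λ y → rank-rank y l⊆s) l)

filter-<-upTo : ∀ {m n} → m ≤ n → filter (_<? m) (upTo n) ≡ upTo m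
filter-<-upTo {m} {zero} z≤n = refl
filter-<-upTo {m} {suc n} m≤1+n with m ≤? n
... | no m≰n rewrite ≤-antisym m≤1+n (≰⇒> m≰n) = filter-all (_<? suc n) (all-upTo (suc n))
... | yes m≤n = begin
  filter (_<? m) (upTo (suc n))                    ≡⟨ cong (filter (_<? m)) (upTo-∷ʳ n) ⟨
  filter (_<? m) (upTo n ++ [ n ])                 ≡⟨ filter-++ (_<? m) (upTo n) [ n ] ⟩
  filter (_<? m) (upTo n) ++ filter (_<? m) [ n ]  ≡⟨ cong₂ _++_ (filter-<-upTo m≤n) n∉ ⟩
  upTo m ++ []                                     ≡⟨ ++-identityʳ (upTo m) ⟩
  upTo m                                           ∎
  where
    open ≡-Reasoning
    n∉ = filter-reject (_<? m) (≤⇒≯ m≤n)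

rank-upTo : ∀ {m n} → m ≤ n → rank m (upTo n) ≡ suc m
rank-upTo {m} m≤n = cong suc (trans (cong length (filter-<-upTo m≤n)) (length-upTo m))

IsPerm-rank : ∀ {n π x} → IsPerm n π → x ∈ π → rank x π ≡ x
IsPerm-rank {n} {π} p x∈π with m , m∈upTo , refl ← ∈-map⁻ suc (∈-resp-↭ p x∈π) = begin
  rank (suc m) π                   ≡⟨ rank-↭ (suc m) p ⟩
  rank (suc m) (map suc (upTo n))  ≡⟨ rank-map suc (upTo n) (All.universal (λ _ → s≤s , s≤s⁻¹) _) ⟩
  rank m (upTo n)                  ≡⟨ rank-upTo (<⇒≤ (∈-upTo⁻ m∈upTo)) ⟩
  suc m                            ∎
  where open ≡-Reasoning

IsPerm-positive : ∀ {n π} → IsPerm n π → All (1 ≤_) π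
IsPerm-positive {n} p = All-resp-↭ (↭-sym p) (map⁺ (All.universal (λ _ → s≤s z≤n) (upTo n)))

IsPerm-unique : ∀ {n π} → IsPerm n π → Unique π
IsPerm-unique {n} p =
  Unique-resp-↭ (setoid ℕ) (↭⇒↭ₛ (↭-sym p)) (Unique.map⁺ suc-injective (Unique.upTo⁺ n))

graft-node-≤ : ∀ {i} l r s → i ≤ leaves l → graft (node l r) i s ≡ node (graft l i s) r
graft-node-≤ {i} l r s i≤ rewrite dec-true (i ≤? leaves l) i≤ = refl

graft-node-> : ∀ {i} l r s → ¬ i ≤ leaves l →
               graft (node l r) i s ≡ node l (graft r (i ∸ leaves l) s)
graft-node-> {i} l r s i≰ rewrite dec-false (i ≤? leaves l) i≰ = refl

infixl 5 _◁_
_◁_ : Tree → ℕ → Tree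
T ◁ i = graft T i corolla

leaves-◁ : ∀ T {i} → 1 ≤ i → i ≤ leaves T → leaves (T ◁ i) ≡ suc (leaves T)
leaves-◁ leaf       (s≤s z≤n) (s≤s z≤n) = refl
leaves-◁ (node l r) {i} 1≤i i≤ with i ≤? leaves l
... | yes i≤L = begin
  leaves (node l r ◁ i)          ≡⟨ cong leaves (graft-node-≤ l r corolla i≤L) ⟩
  leaves (l ◁ i) + leaves r      ≡⟨ cong (_+ leaves r) (leaves-◁ l 1≤i i≤L) ⟩
  suc (leaves l + leaves r)      ∎
  where open ≡-Reasoning
... | no i≰L = begin
  leaves (node l r ◁ i)                 ≡⟨ cong leaves (graft-node-> l r corolla i≰L) ⟩
  leaves l + leaves (r ◁ i ∸ leaves l)  ≡⟨ cong (leaves l +_) (leaves-◁ r 1≤i∸L i∸L≤) ⟩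
  leaves l + suc (leaves r)             ≡⟨ +-suc (leaves l) (leaves r) ⟩
  suc (leaves l + leaves r)             ∎
  where
    open ≡-Reasoning
    1≤i∸L = m<n⇒0<n∸m (≰⇒> i≰L)
    i∸L≤ = m≤n+o⇒m∸n≤o i (leaves l) i≤

-- No upper bound on j is needed: on a leaf, grafting out of range is the identity on both sides.
◁-comm : ∀ T {i j} → 1 ≤ i → i < j → T ◁ j ◁ i ≡ T ◁ i ◁ suc j
◁-comm leaf {1}           {suc (suc j)} _ _ = refl
◁-comm leaf {suc (suc i)} {suc (suc j)} _ _ = refl
◁-comm leaf {suc i}       {1}           _ (s≤s ())
◁-comm (node l r) {i} {j} 1≤i i<j with j ≤? leaves l | i ≤? leaves l
... | yes j≤L | _ = begin
  node l r ◁ j ◁ i        ≡⟨ cong (_◁ i) (graft-node-≤ l r corolla j≤L) ⟩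
  node (l ◁ j) r ◁ i      ≡⟨ graft-node-≤ (l ◁ j) r corolla i≤L′ ⟩
  node (l ◁ j ◁ i) r      ≡⟨ cong (λ t → node t r) (◁-comm l 1≤i i<j) ⟩
  node (l ◁ i ◁ suc j) r  ≡⟨ graft-node-≤ (l ◁ i) r corolla 1+j≤L′ ⟨
  node (l ◁ i) r ◁ suc j  ≡⟨ cong (_◁ suc j) (graft-node-≤ l r corolla i≤L) ⟨
  node l r ◁ i ◁ suc j    ∎
  where
    open ≡-Reasoning
    i≤L = ≤-trans (<⇒≤ i<j) j≤L
    i≤L′ : i ≤ leaves (l ◁ j)
    i≤L′ = subst (i ≤_) (sym (leaves-◁ l (≤-trans 1≤i (<⇒≤ i<j)) j≤L)) (m≤n⇒m≤1+n i≤L)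
    1+j≤L′ : suc j ≤ leaves (l ◁ i)
    1+j≤L′ = subst (suc j ≤_) (sym (leaves-◁ l 1≤i i≤L)) (s≤s j≤L)
... | no j≰L | yes i≤L = begin
  node l r ◁ j ◁ i                           ≡⟨ cong (_◁ i) (graft-node-> l r corolla j≰L) ⟩
  node l (r ◁ j ∸ L) ◁ i                     ≡⟨ graft-node-≤ l _ corolla i≤L ⟩
  node (l ◁ i) (r ◁ j ∸ L)                   ≡⟨ cong (λ k → node (l ◁ i) (r ◁ suc j ∸ k)) Lᵢ ⟨
  node (l ◁ i) (r ◁ suc j ∸ leaves (l ◁ i))  ≡⟨ graft-node-> (l ◁ i) r corolla 1+j≰L′ ⟨
  node (l ◁ i) r ◁ suc j                     ≡⟨ cong (_◁ suc j) (graft-node-≤ l r corolla i≤L) ⟨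
  node l r ◁ i ◁ suc j                       ∎
  where
    open ≡-Reasoning
    L = leaves l
    Lᵢ : leaves (l ◁ i) ≡ suc L
    Lᵢ = leaves-◁ l 1≤i i≤L
    1+j≰L′ : ¬ suc j ≤ leaves (l ◁ i)
    1+j≰L′ = j≰L ∘ s≤s⁻¹ ∘ subst (suc j ≤_) Lᵢ
... | no j≰L | no i≰L = begin
  node l r ◁ j ◁ i                  ≡⟨ cong (_◁ i) (graft-node-> l r corolla j≰L) ⟩
  node l (r ◁ j ∸ L) ◁ i            ≡⟨ graft-node-> l _ corolla i≰L ⟩
  node l (r ◁ j ∸ L ◁ i ∸ L)        ≡⟨ cong (node l) (◁-comm r (m<n⇒0<n∸m L<i) i∸L<j∸L) ⟩
  node l (r ◁ i ∸ L ◁ suc (j ∸ L))  ≡⟨ cong (λ k → node l (r ◁ i ∸ L ◁ k)) 1+j∸L ⟨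
  node l (r ◁ i ∸ L ◁ suc j ∸ L)    ≡⟨ graft-node-> l _ corolla (j≰L ∘ ≤-trans (n≤1+n j)) ⟨
  node l (r ◁ i ∸ L) ◁ suc j        ≡⟨ cong (_◁ suc j) (graft-node-> l r corolla i≰L) ⟨
  node l r ◁ i ◁ suc j              ∎
  where
    open ≡-Reasoning
    L = leaves l
    L<i = ≰⇒> i≰L
    1+j∸L : suc j ∸ L ≡ suc (j ∸ L)
    1+j∸L = +-∸-assoc 1 (<⇒≤ (≰⇒> j≰L))
    i∸L<j∸L = ∸-monoˡ-< i<j (<⇒≤ L<i)

φ-∷ : ∀ a α b l → φ (a ∷ α ++ b ∷ l) ≡ φ (std (α ++ b ∷ l)) ◁ a
φ-∷ a []      b l = cong (λ k → φ-aux k (std (b ∷ l)) ◁ a) (sym (length-map _ (b ∷ l)))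
φ-∷ a (c ∷ α) b l = cong (λ k → φ-aux k (std w) ◁ a) (sym (length-map _ w))
  where w = c ∷ α ++ b ∷ l

φ-std-∷ : ∀ y b l → φ (std (y ∷ b ∷ l)) ≡ φ (std (b ∷ l)) ◁ rank y (b ∷ l)
φ-std-∷ y b l = trans (φ-∷ (f y) [] (f b) (map f l)) (cong₂ (λ w k → φ w ◁ k) std-tail rank-y)
  where
    f = λ z → rank z (y ∷ b ∷ l)
    std-tail = std-relabel {y ∷ b ∷ l} {b ∷ l} there
    rank-y = rank-∷-≮ (b ∷ l) (n≮n y)

φ-swap-head : ∀ {u x v β} → rank u (u ∷ v ∷ β) ≡ u → rank v (u ∷ v ∷ β) ≡ v →
              u < x → x < v → x ∈ β → φ (u ∷ v ∷ β) ≡ φ (v ∷ u ∷ β)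
φ-swap-head {u} {x} {v} {b ∷ l} ru rv u<x x<v x∈β = begin
  φ (u ∷ v ∷ β)                   ≡⟨ φ-∷ u [] v β ⟩
  φ (std (v ∷ β)) ◁ u             ≡⟨ cong (_◁ u) (φ-std-∷ v b l) ⟩
  T ◁ rank v β ◁ u                ≡⟨ cong (T ◁ rank v β ◁_) ru′ ⟨
  T ◁ rank v β ◁ rank u β         ≡⟨ ◁-comm T (s≤s z≤n) (rank-between u<x x<v x∈β) ⟩
  T ◁ rank u β ◁ suc (rank v β)   ≡⟨ cong (T ◁ rank u β ◁_) rv′ ⟩
  T ◁ rank u β ◁ v                ≡⟨ cong (_◁ v) (φ-std-∷ u b l) ⟨
  φ (std (u ∷ β)) ◁ v             ≡⟨ φ-∷ v [] u β ⟨
  φ (v ∷ u ∷ β)                   ∎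
  where
    open ≡-Reasoning
    β = b ∷ l
    T = φ (std β)
    u<v = <-trans u<x x<v
    ru′ : rank u β ≡ u
    ru′ = trans (sym (trans (rank-∷-≮ (v ∷ β) (n≮n u)) (rank-∷-≮ β (<⇒≯ u<v)))) ru
    rv′ : suc (rank v β) ≡ v
    rv′ = trans (sym (trans (rank-∷-< (v ∷ β) u<v) (cong suc (rank-∷-≮ β (n≮n v))))) rv

-- Induction on k = length α, since the recursive call is on the relabelled prefix map f α.
-- The rank hypotheses are only used at the head: for the standardized tail they hold automatically.
φ-swap : ∀ k α {u x v β} → length α ≡ k →
         rank u (α ++ u ∷ v ∷ β) ≡ u → rank v (α ++ u ∷ v ∷ β) ≡ v →
         u < x → x < v → x ∈ β → φ (α ++ u ∷ v ∷ β) ≡ φ (α ++ v ∷ u ∷ β)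
φ-swap _       []      _   ru rv = φ-swap-head ru rv
φ-swap (suc k) (a ∷ α) {u} {x} {v} {β} len _ _ u<x x<v x∈β = begin
  φ (a ∷ π)                               ≡⟨ φ-∷ a α u (v ∷ β) ⟩
  φ (std π) ◁ a                           ≡⟨ cong (λ w → φ w ◁ a) (map-++ f α (u ∷ v ∷ β)) ⟩
  φ (map f α ++ f u ∷ f v ∷ map f β) ◁ a  ≡⟨ cong (_◁ a) relabelled ⟩
  φ (map f α ++ f v ∷ f u ∷ map f β) ◁ a  ≡⟨ cong (λ w → φ w ◁ a) (map-++ f α (v ∷ u ∷ β)) ⟨
  φ (map f ρ) ◁ a                         ≡⟨ cong (λ w → φ w ◁ a) std-ρ ⟩
  φ (std ρ) ◁ a                           ≡⟨ φ-∷ a α v (u ∷ β) ⟨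
  φ (a ∷ ρ)                               ∎
  where
    open ≡-Reasoning
    π = α ++ u ∷ v ∷ β
    ρ = α ++ v ∷ u ∷ β
    π↭ρ : π ↭ ρ
    π↭ρ = ++⁺ˡ α (swap u v ↭-refl)
    f = λ y → rank y π
    std-ρ : map f ρ ≡ std ρ
    std-ρ = map-cong (λ y → rank-↭ y π↭ρ) ρ
    u∈π : u ∈ π
    u∈π = ∈-++⁺ʳ α (here refl)
    x∈π : x ∈ π
    x∈π = ∈-++⁺ʳ α (there (there x∈β))
    rank-fixed : ∀ y → rank (f y) (map f α ++ f u ∷ f v ∷ map f β) ≡ f y
    rank-fixed y = trans (cong (rank (f y)) (sym (map-++ f α (u ∷ v ∷ β)))) (rank-rank {π} {π} y id)
    relabelled = φ-swap k (map f α) (trans (length-map f α) (suc-injective len))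
      (rank-fixed u) (rank-fixed v) (rank-< u<x u∈π) (rank-< x<v x∈π) (∈-map⁺ f x∈β)

Unique-++⁻ˡ : ∀ xs {ys : List ℕ} → Unique (xs ++ ys) → Unique xs
Unique-++⁻ˡ []       _          = []
Unique-++⁻ˡ (x ∷ xs) (x∉ ∷ xs!) = ++⁻ˡ xs x∉ ∷ Unique-++⁻ˡ xs xs!

Unique-++⁻ʳ : ∀ xs {ys : List ℕ} → Unique (xs ++ ys) → Unique ys
Unique-++⁻ʳ []       ys!       = ys!
Unique-++⁻ʳ (x ∷ xs) (_ ∷ xs!) = Unique-++⁻ʳ xs xs!

WF-∘⁻ˡ : ∀ {A B m} → WF (A ∘⟨ m ⟩ B) → WF A
WF-∘⁻ˡ {A} (sh-comp shA _ _ _ , AB!) = shA , Unique-++⁻ˡ (indices A) AB!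

WF-∘⁻ʳ : ∀ {A B m} → WF (A ∘⟨ m ⟩ B) → WF B
WF-∘⁻ʳ {A} (sh-comp _ shB _ _ , AB!) = shB , Unique-++⁻ʳ (indices A) AB!

h-go-++ : ∀ A s xs ys → h-go A s (xs ++ ys) ≡ h-go (h-go A s xs) (s ++ xs) ys
h-go-++ A s []       ys = cong (λ t → h-go A t ys) (sym (++-identityʳ s))
h-go-++ A s (x ∷ xs) ys = trans (h-go-++ (A ∘⟨ rank x s ⟩ two x) (s ∷ʳ x) xs ys)
  (cong (λ t → h-go (h-go (A ∘⟨ rank x s ⟩ two x) (s ∷ʳ x) xs) t ys) (++-assoc s [ x ] xs))

indices-h-go : ∀ A s ys → indices (h-go A s ys) ≡ indices A ++ ys
indices-h-go A s []       = sym (++-identityʳ (indices A))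
indices-h-go A s (y ∷ ys) =
  trans (indices-h-go (A ∘⟨ rank y s ⟩ two y) (s ∷ʳ y) ys) (++-assoc (indices A) [ y ] ys)

Shape-h-go : ∀ {A s} ys → Shape A → arity A ≡ suc (length s) → All (1 ≤_) ys →
             Shape (h-go A s ys)
Shape-h-go         []       shA _  _              = shA
Shape-h-go {A} {s} (y ∷ ys) shA ar (1≤y ∷ ys-pos) =
  Shape-h-go ys (sh-comp shA (sh-two 1≤y) (s≤s z≤n) ry≤arity) ar′ ys-pos
  where
    ry≤arity = subst (rank y s ≤_) (sym ar) (rank-≤ y s)
    ar′ : arity A + 2 ∸ 1 ≡ suc (length (s ∷ʳ y))
    ar′ rewrite ar | length-++ s {[ y ]} = +-suc (length s) 1

WF-h : ∀ {x xs} → All (1 ≤_) (x ∷ xs) → Unique (x ∷ xs) → WF (h (x ∷ xs))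
WF-h {x} {xs} (1≤x ∷ xs-pos) x∷xs! =
  Shape-h-go xs (sh-two 1≤x) refl xs-pos , subst Unique (sym (indices-h-go (two x) [ x ] xs)) x∷xs!

WF-h-go⁻ : ∀ ys {A s} → WF (h-go A s ys) → WF A
WF-h-go⁻ []       wf = wf
WF-h-go⁻ (y ∷ ys) wf = WF-∘⁻ˡ (WF-h-go⁻ ys wf)

h-go-cong : ∀ δ {A B s s′} → s ↭ s′ → A =I B → WF (h-go A s δ) →
            h-go A s δ =I h-go B s′ δ
h-go-cong []       _   A=B _  = A=B
h-go-cong (y ∷ δ) {A} {B} {s} {s′} s↭s′ A=B wf = h-go-cong δ (++⁺ʳ [ y ] s↭s′) insert-y wf
  where
    wfAy = WF-h-go⁻ δ wf
    insert-y : A ∘⟨ rank y s ⟩ two y =I B ∘⟨ rank y s′ ⟩ two y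
    insert-y = subst (λ k → A ∘⟨ rank y s ⟩ two y =I B ∘⟨ k ⟩ two y) (rank-↭ y s↭s′)
                 (=I-cong wfAy A=B (=I-refl (WF-∘⁻ʳ wfAy)))

two-interchange : ∀ {A n m u v} → n < m → WF ((A ∘⟨ n ⟩ two u) ∘⟨ suc m ⟩ two v) →
                  (A ∘⟨ n ⟩ two u) ∘⟨ suc m ⟩ two v =I (A ∘⟨ m ⟩ two v) ∘⟨ n ⟩ two u
two-interchange {A} {n} {suc m} {u} {v} (s≤s n≤m) wf =
  subst (λ k → (A ∘⟨ n ⟩ two u) ∘⟨ 2 + m ⟩ two v =I (A ∘⟨ k ⟩ two v) ∘⟨ n ⟩ two u)
    (+-comm m 1) (assoc2 wf (subst (n + 2 ≤_) (+-comm m 2) (+-monoˡ-≤ 2 n≤m)))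

h-go-swap : ∀ δ {A s u v} → u < v → rank u s < rank v s → WF (h-go A s (u ∷ v ∷ δ)) →
            h-go A s (u ∷ v ∷ δ) =I h-go A s (v ∷ u ∷ δ)
h-go-swap δ {A} {s} {u} {v} u<v ru<rv wf = h-go-cong δ su,v↭sv,u (interchange (WF-h-go⁻ δ wf)) wf
  where
    su,v↭sv,u : s ∷ʳ u ∷ʳ v ↭ s ∷ʳ v ∷ʳ u
    su,v↭sv,u = subst₂ _↭_ (sym (++-assoc s [ u ] [ v ])) (sym (++-assoc s [ v ] [ u ]))
                  (++⁺ˡ s (swap u v ↭-refl))
    interchange : WF ((A ∘⟨ rank u s ⟩ two u) ∘⟨ rank v (s ∷ʳ u) ⟩ two v) →
                  (A ∘⟨ rank u s ⟩ two u) ∘⟨ rank v (s ∷ʳ u) ⟩ two v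
                    =I (A ∘⟨ rank v s ⟩ two v) ∘⟨ rank u (s ∷ʳ v) ⟩ two u
    interchange rewrite rank-∷ʳ-< s u<v | rank-∷ʳ-≮ s (<⇒≯ u<v) = two-interchange ru<rv

h-swap : ∀ γ δ {u x v} → All (1 ≤_) (γ ++ u ∷ v ∷ δ) → Unique (γ ++ u ∷ v ∷ δ) →
         u < x → x < v → x ∈ γ → h (γ ++ u ∷ v ∷ δ) =I h (γ ++ v ∷ u ∷ δ)
h-swap (c ∷ γ) δ {u} {x} {v} pos uniq u<x x<v x∈γ
  rewrite h-go-++ (two c) [ c ] γ (u ∷ v ∷ δ) | h-go-++ (two c) [ c ] γ (v ∷ u ∷ δ) =
  h-go-swap δ {T} {c ∷ γ} (<-trans u<x x<v) (rank-between u<x x<v x∈γ) wf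
  where
    T = h-go (two c) [ c ] γ
    wf : WF (h-go T (c ∷ γ) (u ∷ v ∷ δ))
    wf = subst WF (h-go-++ (two c) [ c ] γ (u ∷ v ∷ δ)) (WF-h pos uniq)

reverse-++-∷-∷ : ∀ α (u v : ℕ) β →
                 reverse (α ++ u ∷ v ∷ β) ≡ reverse β ++ v ∷ u ∷ reverse α
reverse-++-∷-∷ α u v β = begin
  reverse (α ++ u ∷ v ∷ β)                ≡⟨ reverse-++ α (u ∷ v ∷ β) ⟩
  reverse (u ∷ v ∷ β) ++ reverse α        ≡⟨ cong (_++ reverse α) (reverse-++ (u ∷ v ∷ []) β) ⟩
  (reverse β ++ v ∷ u ∷ []) ++ reverse α  ≡⟨ ++-assoc (reverse β) (v ∷ u ∷ []) (reverse α) ⟩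
  reverse β ++ v ∷ u ∷ reverse α          ∎
  where open ≡-Reasoning

lemma5p2 : (n u v : ℕ) (α β : List ℕ) →
    IsPerm n (α ++ u ∷ v ∷ β) →
    u < v →
    (∃[ x ] (x ∈ β × u < x × x < v)) →
    (h (reverse (α ++ u ∷ v ∷ β)) =I h (reverse (α ++ v ∷ u ∷ β)))
      × (φ (α ++ u ∷ v ∷ β) ≡ φ (α ++ v ∷ u ∷ β))
lemma5p2 n u v α β perm _ (x , x∈β , u<x , x<v) = h-equiv , φ-equal
  where
    ρ = α ++ v ∷ u ∷ β
    wρ-perm : IsPerm n (reverse β ++ u ∷ v ∷ reverse α)
    wρ-perm = subst (IsPerm n) (reverse-++-∷-∷ α v u β)
                (↭-trans (↭-reverse ρ) (↭-trans (++⁺ˡ α (swap v u ↭-refl)) perm))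
    h-equiv : h (reverse (α ++ u ∷ v ∷ β)) =I h (reverse ρ)
    h-equiv rewrite reverse-++-∷-∷ α u v β | reverse-++-∷-∷ α v u β =
      =I-sym (h-swap (reverse β) (reverse α) (IsPerm-positive wρ-perm) (IsPerm-unique wρ-perm)
                     u<x x<v (reverse⁺ x∈β))
    φ-equal : φ (α ++ u ∷ v ∷ β) ≡ φ ρ
    φ-equal = φ-swap (length α) α refl (IsPerm-rank perm (∈-++⁺ʳ α (here refl)))
                (IsPerm-rank perm (∈-++⁺ʳ α (there (here refl)))) u<x x<v x∈β
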